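{- The variety $\mathcal{CHA}$ of connexive Heyting algebras has a quaternary deductive term: there is a term $\varphi(x,y,z,w)$ in the language $\langle\wedge,\vee,\rightarrow,0,1\rangle$ such that for every $\mathbf A\in\mathcal{CHA}$ and all $a,b,c,d\in A$, $\varphi^{\mathbf A}(a,b,c,d)=c$ if $a=b$, and $\varphi^{\mathbf A}(a,b,c,d)=d$ if $\langle c,d\rangle\in\theta^{\mathbf A}(a,b)$.
   Context: $\theta^{\mathbf A}(a,b)$ denotes the principal congruence of $\mathbf A$ generated by the pair $\langle a,b\rangle$. A connexive Heyting algebra is an algebra $\langle A,\wedge,\vee,\rightarrow,0,1\rangle$ whose $\{\wedge,\vee,0,1\}$-reduct is a bounded distributive lattice (order $\le$) satisfying, with $\neg x:=x\rightarrow0$: (C1) $(x\rightarrow y)\rightarrow((y\rightarrow z)\rightarrow(x\rightarrow z))=1$; (C2) $(x\rightarrow y)\rightarrow\neg(x\rightarrow\neg y)=1$; (C3) $x\wedge(x\rightarrow y)=x\wedge y$; (C4) $x\rightarrow y\le(z\wedge x)\rightarrow(z\wedge y)$; (C5) $x\rightarrow y\le(z\vee x)\rightarrow(z\vee y)$. $\mathcal{CHA}$ is the variety of all such algebras. -}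

module Defs where

open import Level using (Level; suc; _⊔_; Setω)
open import Data.Nat using (ℕ)
open import Data.Fin using (Fin)
open import Relation.Binary.PropositionalEquality using (_≡_)
open import Algebra.Lattice.Structures using (IsDistributiveLattice)

record CHA (a : Level) : Set (suc a) where
  infixr 5 _⇒_
  infixr 7 _∧_
  infixr 6 _∨_
  field
    Carrier : Set a
    _∧_ _∨_ _⇒_ : Carrier → Carrier → Carrier
    𝟘 𝟙 : Carrier
    isDistributiveLattice : IsDistributiveLattice _≡_ _∨_ _∧_
    ∧-identityʳ : ∀ x → (x ∧ 𝟙) ≡ x
    ∨-identityʳ : ∀ x → (x ∨ 𝟘) ≡ x

  _≤_ : Carrier → Carrier → Set a
  x ≤ y = (x ∧ y) ≡ x

  ¬_ : Carrier → Carrier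
  ¬ x = x ⇒ 𝟘

  field
    C1 : ∀ x y z → ((x ⇒ y) ⇒ ((y ⇒ z) ⇒ (x ⇒ z))) ≡ 𝟙
    C2 : ∀ x y → ((x ⇒ y) ⇒ (¬ (x ⇒ (¬ y)))) ≡ 𝟙
    C3 : ∀ x y → (x ∧ (x ⇒ y)) ≡ (x ∧ y)
    C4 : ∀ x y z → (x ⇒ y) ≤ ((z ∧ x) ⇒ (z ∧ y))
    C5 : ∀ x y z → (x ⇒ y) ≤ ((z ∨ x) ⇒ (z ∨ y))

data Term (n : ℕ) : Set where
  var  : Fin n → Term n
  _∧ₜ_ _∨ₜ_ _⇒ₜ_ : Term n → Term n → Term n
  0ₜ 1ₜ : Term n

⟦_⟧ : ∀ {a n} → Term n → (A : CHA a) → (Fin n → CHA.Carrier A) → CHA.Carrier A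
⟦ var i ⟧ A ρ = ρ i
⟦ s ∧ₜ t ⟧ A ρ = CHA._∧_ A (⟦ s ⟧ A ρ) (⟦ t ⟧ A ρ)
⟦ s ∨ₜ t ⟧ A ρ = CHA._∨_ A (⟦ s ⟧ A ρ) (⟦ t ⟧ A ρ)
⟦ s ⇒ₜ t ⟧ A ρ = CHA._⇒_ A (⟦ s ⟧ A ρ) (⟦ t ⟧ A ρ)
⟦ 0ₜ ⟧ A ρ = CHA.𝟘 A
⟦ 1ₜ ⟧ A ρ = CHA.𝟙 A

eval4 : ∀ {ℓ} → Term 4 → (A : CHA ℓ) → (a b c d : CHA.Carrier A) → CHA.Carrier A
eval4 φ A a b c d = ⟦ φ ⟧ A env
  where
  env : Fin 4 → CHA.Carrier A
  env Fin.zero = a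
  env (Fin.suc Fin.zero) = b
  env (Fin.suc (Fin.suc Fin.zero)) = c
  env (Fin.suc (Fin.suc (Fin.suc Fin.zero))) = d

data θ {ℓ} (A : CHA ℓ) (a b : CHA.Carrier A) : CHA.Carrier A → CHA.Carrier A → Set ℓ where
  gen   : θ A a b a b
  refl  : ∀ {x} → θ A a b x x
  sym   : ∀ {x y} → θ A a b x y → θ A a b y x
  trans : ∀ {x y z} → θ A a b x y → θ A a b y z → θ A a b x z
  ∧-cong : ∀ {x x' y y'} → θ A a b x x' → θ A a b y y' → θ A a b (CHA._∧_ A x y) (CHA._∧_ A x' y')
  ∨-cong : ∀ {x x' y y'} → θ A a b x x' → θ A a b y y' → θ A a b (CHA._∨_ A x y) (CHA._∨_ A x' y')
  ⇒-cong : ∀ {x x' y y'} → θ A a b x x' → θ A a b y y' → θ A a b (CHA._⇒_ A x y) (CHA._⇒_ A x' y')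

record QuaternaryDeductiveTerm : Setω where
  field
    φ : Term 4
    on-equal : ∀ {ℓ} (A : CHA ℓ) (a b c d : CHA.Carrier A) →
               a ≡ b → eval4 φ A a b c d ≡ c
    on-θ     : ∀ {ℓ} (A : CHA ℓ) (a b c d : CHA.Carrier A) →
               θ A a b c d → eval4 φ A a b c d ≡ d

{-# OPTIONS --safe #-}
-- In a connexive Heyting algebra put  a ⇔ b = (a → a ∧ b) ∧ (b → b ∧ a)  and
-- φ(a,b,c,d) = ((a ⇔ b) → (a ⇔ b) ∧ c) ∧ ((a ⇔ b) ∨ d).  If a = b then a ⇔ b = 1 and
-- φ reduces to c.  In general e = a ⇔ b satisfies e ∧ a = e ∧ b, and the relation
-- e ∧ x = e ∧ y is a congruence for every e, the case of → resting on the fact that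
-- e ∧ x = e ∧ y forces e ≤ y → x.  Hence every pair ⟨c,d⟩ ∈ θ(a,b) has e ∧ c = e ∧ d,
-- and then φ collapses to d.
module Submission where

open import Level using (Level)
open import Data.Fin using (zero; suc)
open import Relation.Binary.PropositionalEquality
  using (_≡_; refl; sym; trans; cong; cong₂; subst; subst₂; module ≡-Reasoning)
open import Algebra.Lattice.Bundles using (DistributiveLattice)
import Algebra.Lattice.Properties.Lattice as LatticeProperties
open import Relation.Binary.Lattice using (MeetSemilattice)
import Relation.Binary.Lattice.Properties.MeetSemilattice as MeetSemilatticeProperties
import Relation.Binary.Reasoning.PartialOrder as ≤-Reasoning
open import Defs
  using (CHA; Term; var; _∧ₜ_; _∨ₜ_; _⇒ₜ_; θ; module θ; QuaternaryDeductiveTerm)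

module CHAProperties {ℓ : Level} (A : CHA ℓ) where
  open CHA A hiding (_≤_)

  distributiveLattice : DistributiveLattice ℓ ℓ
  distributiveLattice = record { isDistributiveLattice = isDistributiveLattice }

  open DistributiveLattice distributiveLattice
    using (∧-comm; ∧-assoc; ∨-comm; ∨-absorbs-∧; ∧-distribˡ-∨; lattice)
  open LatticeProperties lattice using (∧-idem; ∧-orderTheoreticMeetSemilattice)
  -- Here x ≤ y means x ≡ x ∧ y, the mirror image of CHA._≤_; hence the syms applied to (C4).
  open MeetSemilattice ∧-orderTheoreticMeetSemilattice
    using (_≤_; poset; x∧y≤x; x∧y≤y; ∧-greatest)
    renaming (refl to ≤-refl; trans to ≤-trans; antisym to ≤-antisym)
  open MeetSemilatticeProperties ∧-orderTheoreticMeetSemilattice using (∧-monotonic)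

  ∧-identityˡ : ∀ x → 𝟙 ∧ x ≡ x
  ∧-identityˡ x = trans (∧-comm 𝟙 x) (∧-identityʳ x)

  ∨-zeroˡ : ∀ x → 𝟙 ∨ x ≡ 𝟙
  ∨-zeroˡ x = trans (cong (𝟙 ∨_) (sym (∧-identityˡ x))) (∨-absorbs-∧ 𝟙 x)

  x≤𝟙 : ∀ x → x ≤ 𝟙
  x≤𝟙 x = sym (∧-identityʳ x)

  ⇒-identityˡ : ∀ y → 𝟙 ⇒ y ≡ y
  ⇒-identityˡ y = begin
    𝟙 ⇒ y        ≡⟨ sym (∧-identityˡ (𝟙 ⇒ y)) ⟩
    𝟙 ∧ (𝟙 ⇒ y)  ≡⟨ C3 𝟙 y ⟩
    𝟙 ∧ y        ≡⟨ ∧-identityˡ y ⟩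
    y            ∎
    where open ≡-Reasoning

  ⇒≡𝟙⇒≤ : ∀ {x y} → x ⇒ y ≡ 𝟙 → x ≤ y
  ⇒≡𝟙⇒≤ {x} {y} x⇒y≡𝟙 = begin
    x            ≡⟨ sym (∧-identityʳ x) ⟩
    x ∧ 𝟙        ≡⟨ cong (x ∧_) (sym x⇒y≡𝟙) ⟩
    x ∧ (x ⇒ y)  ≡⟨ C3 x y ⟩
    x ∧ y        ∎
    where open ≡-Reasoning

  modus-ponens : ∀ x y → x ∧ (x ⇒ y) ≤ y
  modus-ponens x y = subst (_≤ y) (sym (C3 x y)) (x∧y≤y x y)

  ≤-⇒𝟙 : ∀ x → x ≤ x ⇒ 𝟙
  ≤-⇒𝟙 x = sym (trans (C3 x 𝟙) (∧-identityʳ x))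

  ≤-⇒-∧ : ∀ x y → y ≤ x ⇒ (x ∧ y)
  ≤-⇒-∧ x y = subst₂ _≤_ (⇒-identityˡ y) (cong (_⇒ (x ∧ y)) (∧-identityʳ x)) (sym (C4 𝟙 y x))

  ∧-⇒-≤ : ∀ x y → x ≤ (x ∧ y) ⇒ y
  ∧-⇒-≤ x y = ≤-trans (≤-⇒𝟙 x)
    (subst₂ (λ s t → x ⇒ 𝟙 ≤ s ⇒ t) (∧-comm y x) (∧-identityʳ y) (sym (C4 x 𝟙 y)))

  ⇒-trans : ∀ x y z → (x ⇒ y) ∧ (y ⇒ z) ≤ x ⇒ z
  ⇒-trans x y z = begin
    (x ⇒ y) ∧ (y ⇒ z)              ≤⟨ ∧-monotonic (⇒≡𝟙⇒≤ (C1 x y z)) ≤-refl ⟩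
    ((y ⇒ z) ⇒ (x ⇒ z)) ∧ (y ⇒ z)  ≡⟨ ∧-comm _ (y ⇒ z) ⟩
    (y ⇒ z) ∧ ((y ⇒ z) ⇒ (x ⇒ z))  ≤⟨ modus-ponens (y ⇒ z) (x ⇒ z) ⟩
    x ⇒ z                          ∎
    where open ≤-Reasoning poset

  infix 4 _≡[_]_
  _≡[_]_ : Carrier → Carrier → Carrier → Set ℓ
  x ≡[ e ] y = e ∧ x ≡ e ∧ y

  ≡[]⇒≤⇒ : ∀ {e x y} → x ≡[ e ] y → e ≤ y ⇒ x
  ≡[]⇒≤⇒ {e} {x} {y} x≡y = begin
    e                              ≤⟨ ∧-greatest (≤-⇒-∧ y e) (∧-⇒-≤ e x) ⟩
    (y ⇒ (y ∧ e)) ∧ ((e ∧ x) ⇒ x)  ≡⟨ cong (λ t → (y ⇒ t) ∧ ((e ∧ x) ⇒ x)) y∧e≡e∧x ⟩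
    (y ⇒ (e ∧ x)) ∧ ((e ∧ x) ⇒ x)  ≤⟨ ⇒-trans y (e ∧ x) x ⟩
    y ⇒ x                          ∎
    where
    open ≤-Reasoning poset
    y∧e≡e∧x : y ∧ e ≡ e ∧ x
    y∧e≡e∧x = trans (∧-comm y e) (sym x≡y)

  ≡[]-∧-congʳ : ∀ {e x x'} y → x ≡[ e ] x' → x ∧ y ≡[ e ] x' ∧ y
  ≡[]-∧-congʳ {e} {x} {x'} y x≡x' =
    trans (sym (∧-assoc e x y)) (trans (cong (_∧ y) x≡x') (∧-assoc e x' y))

  ≡[]-∧-cong : ∀ {e x x' y y'} → x ≡[ e ] x' → y ≡[ e ] y' → x ∧ y ≡[ e ] x' ∧ y'
  ≡[]-∧-cong {e} {x} {x'} {y} {y'} x≡x' y≡y' = begin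
    e ∧ (x ∧ y)    ≡⟨ ≡[]-∧-congʳ y x≡x' ⟩
    e ∧ (x' ∧ y)   ≡⟨ cong (e ∧_) (∧-comm x' y) ⟩
    e ∧ (y ∧ x')   ≡⟨ ≡[]-∧-congʳ x' y≡y' ⟩
    e ∧ (y' ∧ x')  ≡⟨ cong (e ∧_) (∧-comm y' x') ⟩
    e ∧ (x' ∧ y')  ∎
    where open ≡-Reasoning

  ≡[]-∨-cong : ∀ {e x x' y y'} → x ≡[ e ] x' → y ≡[ e ] y' → x ∨ y ≡[ e ] x' ∨ y'
  ≡[]-∨-cong {e} {x} {x'} {y} {y'} x≡x' y≡y' = begin
    e ∧ (x ∨ y)            ≡⟨ ∧-distribˡ-∨ e x y ⟩
    (e ∧ x) ∨ (e ∧ y)      ≡⟨ cong₂ _∨_ x≡x' y≡y' ⟩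
    (e ∧ x') ∨ (e ∧ y')    ≡⟨ sym (∧-distribˡ-∨ e x' y') ⟩
    e ∧ (x' ∨ y')          ∎
    where open ≡-Reasoning

  ≡[]-⇒-mono : ∀ {e x x' y y'} → x ≡[ e ] x' → y ≡[ e ] y' → e ∧ (x ⇒ y) ≤ e ∧ (x' ⇒ y')
  ≡[]-⇒-mono {e} {x} {x'} {y} {y'} x≡x' y≡y' = ∧-greatest (x∧y≤x e (x ⇒ y)) (begin
    e ∧ (x ⇒ y)                        ≤⟨ ∧-greatest (∧-monotonic (≡[]⇒≤⇒ x≡x') ≤-refl) e≤y⇒y' ⟩
    ((x' ⇒ x) ∧ (x ⇒ y)) ∧ (y ⇒ y')    ≤⟨ ∧-monotonic (⇒-trans x' x y) ≤-refl ⟩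
    (x' ⇒ y) ∧ (y ⇒ y')                ≤⟨ ⇒-trans x' y y' ⟩
    x' ⇒ y'                            ∎)
    where
    open ≤-Reasoning poset
    e≤y⇒y' : e ∧ (x ⇒ y) ≤ y ⇒ y'
    e≤y⇒y' = ≤-trans (x∧y≤x e (x ⇒ y)) (≡[]⇒≤⇒ (sym y≡y'))

  ≡[]-⇒-cong : ∀ {e x x' y y'} → x ≡[ e ] x' → y ≡[ e ] y' → x ⇒ y ≡[ e ] x' ⇒ y'
  ≡[]-⇒-cong x≡x' y≡y' = ≤-antisym (≡[]-⇒-mono x≡x' y≡y') (≡[]-⇒-mono (sym x≡x') (sym y≡y'))

  infix 5 _⇔_
  _⇔_ : Carrier → Carrier → Carrier
  a ⇔ b = (a ⇒ (a ∧ b)) ∧ (b ⇒ (b ∧ a))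

  ⇔-∧ : ∀ a b → (a ⇔ b) ∧ a ≡ a ∧ b
  ⇔-∧ a b = ≤-antisym upper lower
    where
    open ≤-Reasoning poset
    upper : (a ⇔ b) ∧ a ≤ a ∧ b
    upper = begin
      (a ⇔ b) ∧ a             ≤⟨ ∧-monotonic (x∧y≤x _ _) ≤-refl ⟩
      (a ⇒ (a ∧ b)) ∧ a       ≡⟨ ∧-comm _ a ⟩
      a ∧ (a ⇒ (a ∧ b))       ≤⟨ modus-ponens a (a ∧ b) ⟩
      a ∧ b                   ∎
    lower : a ∧ b ≤ (a ⇔ b) ∧ a
    lower = ∧-greatest
      (∧-greatest (≤-trans (x∧y≤y a b) (≤-⇒-∧ a b)) (≤-trans (x∧y≤x a b) (≤-⇒-∧ b a)))
      (x∧y≤x a b)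

  ⇔-equalizes : ∀ a b → a ≡[ a ⇔ b ] b
  ⇔-equalizes a b = begin
    (a ⇔ b) ∧ a  ≡⟨ ⇔-∧ a b ⟩
    a ∧ b        ≡⟨ ∧-comm a b ⟩
    b ∧ a        ≡⟨ sym (⇔-∧ b a) ⟩
    (b ⇔ a) ∧ b  ≡⟨ cong (_∧ b) (∧-comm _ _) ⟩
    (a ⇔ b) ∧ b  ∎
    where open ≡-Reasoning

  θ⊆≡[⇔] : ∀ {a b c d} → θ A a b c d → c ≡[ a ⇔ b ] d
  θ⊆≡[⇔] {a} {b} θ.gen  = ⇔-equalizes a b
  θ⊆≡[⇔] θ.refl         = refl
  θ⊆≡[⇔] (θ.sym t)      = sym (θ⊆≡[⇔] t)
  θ⊆≡[⇔] (θ.trans t u)  = trans (θ⊆≡[⇔] t) (θ⊆≡[⇔] u)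
  θ⊆≡[⇔] (θ.∧-cong t u) = ≡[]-∧-cong (θ⊆≡[⇔] t) (θ⊆≡[⇔] u)
  θ⊆≡[⇔] (θ.∨-cong t u) = ≡[]-∨-cong (θ⊆≡[⇔] t) (θ⊆≡[⇔] u)
  θ⊆≡[⇔] (θ.⇒-cong t u) = ≡[]-⇒-cong (θ⊆≡[⇔] t) (θ⊆≡[⇔] u)

  ⇔-refl : ∀ a → a ⇔ a ≡ 𝟙
  ⇔-refl a = ≤-antisym (x≤𝟙 (a ⇔ a)) (∧-greatest 𝟙≤a⇒a∧a 𝟙≤a⇒a∧a)
    where
    𝟙≤a⇒a∧a : 𝟙 ≤ a ⇒ (a ∧ a)
    𝟙≤a⇒a∧a = subst (λ t → 𝟙 ≤ a ⇒ t) (trans (∧-identityʳ a) (sym (∧-idem a))) (≤-⇒-∧ a 𝟙)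

  select : Carrier → Carrier → Carrier → Carrier
  select e c d = (e ⇒ (e ∧ c)) ∧ (e ∨ d)

  select-𝟙 : ∀ c d → select 𝟙 c d ≡ c
  select-𝟙 c d = begin
    (𝟙 ⇒ (𝟙 ∧ c)) ∧ (𝟙 ∨ d)  ≡⟨ cong₂ _∧_ (trans (⇒-identityˡ (𝟙 ∧ c)) (∧-identityˡ c)) (∨-zeroˡ d) ⟩
    c ∧ 𝟙                    ≡⟨ ∧-identityʳ c ⟩
    c                        ∎
    where open ≡-Reasoning

  select-⇔-≡ : ∀ {a b} c d → a ≡ b → select (a ⇔ b) c d ≡ c
  select-⇔-≡ {a} c d refl = trans (cong (λ e → select e c d) (⇔-refl a)) (select-𝟙 c d)

  select-≡[] : ∀ {e c d} → c ≡[ e ] d → select e c d ≡ d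
  select-≡[] {e} {c} {d} c≡d = begin
    (e ⇒ (e ∧ c)) ∧ (e ∨ d)   ≡⟨ cong (λ t → (e ⇒ t) ∧ (e ∨ d)) c≡d ⟩
    h ∧ (e ∨ d)               ≡⟨ ∧-distribˡ-∨ h e d ⟩
    (h ∧ e) ∨ (h ∧ d)         ≡⟨ cong₂ _∨_ h∧e≡e∧d (trans (∧-comm h d) (sym (≤-⇒-∧ e d))) ⟩
    (e ∧ d) ∨ d               ≡⟨ ∨-comm (e ∧ d) d ⟩
    d ∨ (e ∧ d)               ≡⟨ cong (d ∨_) (∧-comm e d) ⟩
    d ∨ (d ∧ e)               ≡⟨ ∨-absorbs-∧ d e ⟩
    d                         ∎
    where
    open ≡-Reasoning
    h : Carrier
    h = e ⇒ (e ∧ d)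
    h∧e≡e∧d : h ∧ e ≡ e ∧ d
    h∧e≡e∧d = begin
      h ∧ e          ≡⟨ ∧-comm h e ⟩
      e ∧ h          ≡⟨ C3 e (e ∧ d) ⟩
      e ∧ (e ∧ d)    ≡⟨ sym (∧-assoc e e d) ⟩
      (e ∧ e) ∧ d    ≡⟨ cong (_∧ d) (∧-idem e) ⟩
      e ∧ d          ∎

-- Evaluates definitionally to CHAProperties.select A (a ⇔ b) c d.
deductiveTerm : Term 4
deductiveTerm = (e ⇒ₜ (e ∧ₜ z)) ∧ₜ (e ∨ₜ w)
  where
  x y z w e : Term 4
  x = var zero
  y = var (suc zero)
  z = var (suc (suc zero))
  w = var (suc (suc (suc zero)))
  e = (x ⇒ₜ (x ∧ₜ y)) ∧ₜ (y ⇒ₜ (y ∧ₜ x))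

theorem3p11 : QuaternaryDeductiveTerm
theorem3p11 = record
  { φ        = deductiveTerm
  ; on-equal = λ A a b c d a≡b → CHAProperties.select-⇔-≡ A c d a≡b
  ; on-θ     = λ A a b c d c≡d → CHAProperties.select-≡[] A (CHAProperties.θ⊆≡[⇔] A c≡d)
  }
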